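{- For every $n \ge 1$ and every vector $s=(s_1,\dotsc,s_n) \in \mathbb{Z}_{\ge 0}^n$, the bit adder function $\mathrm{BA}_n^{s}\colon\{0,1\}^n\to\{0,1\}^m$ can be computed by a Boolean circuit over the full binary basis of size at most $4.5n-2m$.
   Context: A Boolean circuit over the full binary basis is a directed acyclic graph whose source nodes (input gates) are labeled by the input variables $x_1,\dotsc,x_n$ and the constants $0,1$, and whose other nodes (internal gates) have in-degree $2$ and are labeled by arbitrary binary Boolean operations; some gates are designated as outputs. The size of a circuit is its number of internal gates, and $\operatorname{size}(f)$ is the minimum size of a circuit computing $f$. For $s \in \mathbb{Z}_{\ge 0}^n$, the bit adder $\mathrm{BA}_n^s$ maps $(x_1,\dotsc,x_n)\in\{0,1\}^n$ to $(y_0,\dotsc,y_{m-1})\in\{0,1\}^m$, where $0\le t_0<t_1<\dotsb<t_{m-1}$ are exactly those bit positions of the binary representation of $\sum_{i=1}^n 2^{s_i}x_i$ that are not identically zero as functions of the input, and $y_j$ is the bit at position $t_j$, so that $\sum_{i=1}^n 2^{s_i}x_i=\sum_{j=0}^{m-1}2^{t_j}y_j$. (Here $m\le n$ is determined by $s$.) -}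

module Defs where

open import Data.Bool using (Bool; true; false; if_then_else_)
open import Data.Nat using (ℕ; zero; suc; _+_; _*_; _^_; _≤_; _<_; _%_; _/_; _≡ᵇ_)
open import Data.Fin using (Fin) renaming (_<_ to _<ᶠ_)
open import Data.Vec using (Vec; []; _∷_; lookup; tabulate; sum)
open import Data.Product using (_×_; Σ; ∃; _,_)
open import Relation.Binary.PropositionalEquality using (_≡_)

Gate : ℕ → Set
Gate w = (Bool → Bool → Bool) × Fin w × Fin w

-- Nodes before any gate: constant 0, constant 1, inputs x_1..x_n (2 + n nodes).
data Gates (n : ℕ) : ℕ → Set where
  []  : Gates n zero
  _▹_ : ∀ {k} → Gates n k → Gate (k + (2 + n)) → Gates n (suc k)

-- Values of all nodes (most recent gate first, then 0, 1, x_1..x_n).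
eval : ∀ {n k} → Gates n k → (Fin n → Bool) → Vec Bool (k + (2 + n))
eval [] x = false ∷ true ∷ tabulate x
eval (c ▹ (op , i , j)) x = let v = eval c x in op (lookup v i) (lookup v j) ∷ v

record Circuit (n m : ℕ) : Set where
  field
    size    : ℕ
    gates   : Gates n size
    outputs : Vec (Fin (size + (2 + n))) m

open Circuit public

run : ∀ {n m} → Circuit n m → (Fin n → Bool) → Fin m → Bool
run C x j = lookup (eval (gates C) x) (lookup (outputs C) j)

Computes : ∀ {n m} → Circuit n m → ((Fin n → Bool) → Fin m → Bool) → Set
Computes C f = ∀ x j → run C x j ≡ f x j

bit : ℕ → ℕ → Bool
bit zero    N = N % 2 ≡ᵇ 1
bit (suc p) N = bit p (N / 2)

weightedSum : ∀ {n} → (Fin n → ℕ) → (Fin n → Bool) → ℕ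
weightedSum s x = sum (tabulate λ i → if x i then 2 ^ s i else 0)

IsBitAdderPositions : ∀ {n m} → (Fin n → ℕ) → (Fin m → ℕ) → Set
IsBitAdderPositions {n} {m} s t =
  (∀ (i j : Fin m) → i <ᶠ j → t i < t j) ×
  (∀ (p : ℕ) → ((Σ (Fin n → Bool) λ x → bit p (weightedSum s x) ≡ true) → ∃ λ j → t j ≡ p)
              × ((∃ λ j → t j ≡ p) → Σ (Fin n → Bool) λ x → bit p (weightedSum s x) ≡ true))

BA : ∀ {n m} → (Fin n → ℕ) → (Fin m → ℕ) → (Fin n → Bool) → Fin m → Bool
BA s t x j = bit (t j) (weightedSum s x)

-- Proof idea (following Demenkov, Kojevnikov, Kulikov and Yaroslavtsev). Sum the
-- columns of bits of equal weight from the least significant one upwards. The bits of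
-- a column are kept either as single wires or as pairs (u , u xor v) encoding u + v;
-- a single is given a budget of 4.5 gates, a pair 8. XOR-ing two singles into a pair
-- costs one gate, and a chain of MDFA blocks (8 gates each, z + pair + pair = out + 2 pair)
-- reduces the column to one output bit and carries of double weight; every block pays
-- for itself, the chain is closed by a full adder or started by a half adder within the
-- budget, and each output bit leaves 2 gates of the budget unspent.

module Submission where

open import Data.Bool using (Bool; true; false; _xor_; _∧_; _∨_; not; if_then_else_)
open import Data.Empty using (⊥-elim)
open import Data.Fin using (Fin; zero; suc; _↑ʳ_) renaming (_<_ to _<ᶠ_)
open import Data.Fin.Patterns using (0F; 1F; 3F; 5F; 6F)
open import Data.List using (List; []; _∷_; length; map; _++_)
open import Data.List.Properties using (map-∘; map-cong; map-++; length-map; length-++)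
open import Data.Maybe using (Maybe; just; nothing; fromMaybe; Is-just) renaming (map to mapMaybe)
open import Data.Maybe.Relation.Unary.Any using (just)
open import Data.Nat using (ℕ; zero; suc; _+_; _*_; _^_; _≤_; _<_; _≡ᵇ_; _%_; _/_; z≤n; s≤s; pred; >-nonZero)
open import Data.Nat.Divisibility using (divides)
open import Data.Nat.DivMod using ([m+kn]%n≡m%n; m*n/n≡m; +-distrib-/-∣ʳ)
open import Data.Nat.ListAction using () renaming (sum to sumₗ)
open import Data.Nat.ListAction.Properties using (sum-++)
open import Data.Nat.Properties
open import Data.Nat.Tactic.RingSolver using (solve-∀)
open import Data.Product using (Σ; _×_; _,_; proj₁; proj₂)
open import Data.Unit using (tt)
open import Data.Vec as Vec using (lookup; tabulate)
open import Data.Vec.Properties using (lookup∘tabulate)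
open import Function using (_∘_)
open import Relation.Binary.PropositionalEquality
open import Algebra.Properties.Semiring.Sum +-*-semiring using (sum-syntax; ∑-distrib-+; *-distribˡ-sum; sum-cong-≗)
open import Defs renaming (_▹_ to infixl 5 _▹_)

toℕ : Bool → ℕ
toℕ b = if b then 1 else 0

-- A pair of wires (u , w) carries the two bits u and u xor w, i.e. the number u + (u xor w).
-- This is the encoding on which the MDFA block of Demenkov, Kojevnikov, Kulikov and
-- Yaroslavtsev operates.
decodePair : Bool → Bool → ℕ
decodePair u w = toℕ u + toℕ (u xor w)

xor-decodePair : ∀ u v → decodePair u (u xor v) ≡ toℕ u + toℕ v
xor-decodePair false v     = refl
xor-decodePair true  false = refl
xor-decodePair true  true  = refl

halfAdder-decodePair : ∀ u w → decodePair u w ≡ toℕ w + 2 * toℕ (u ∧ not w)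
halfAdder-decodePair false false = refl
halfAdder-decodePair false true  = refl
halfAdder-decodePair true  false = refl
halfAdder-decodePair true  true  = refl

fullAdder-sum : ∀ z u w →
  toℕ z + decodePair u w ≡ toℕ (z xor w) + 2 * toℕ (u xor (w ∧ (z xor u)))
fullAdder-sum false false false = refl
fullAdder-sum false false true  = refl
fullAdder-sum false true  false = refl
fullAdder-sum false true  true  = refl
fullAdder-sum true  false false = refl
fullAdder-sum true  false true  = refl
fullAdder-sum true  true  false = refl
fullAdder-sum true  true  true  = refl

mdfa-sum : ∀ z u₁ w₁ u₂ w₂ →
  let a = z xor w₁
      c = not w₂ ∧ (a xor u₂)
  in toℕ z + decodePair u₁ w₁ + decodePair u₂ w₂
       ≡ toℕ (a xor w₂) + 2 * decodePair (a xor c) ((w₁ ∨ (z xor u₁)) xor c)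
mdfa-sum false false false false false = refl
mdfa-sum false false false false true  = refl
mdfa-sum false false false true  false = refl
mdfa-sum false false false true  true  = refl
mdfa-sum false false true  false false = refl
mdfa-sum false false true  false true  = refl
mdfa-sum false false true  true  false = refl
mdfa-sum false false true  true  true  = refl
mdfa-sum false true  false false false = refl
mdfa-sum false true  false false true  = refl
mdfa-sum false true  false true  false = refl
mdfa-sum false true  false true  true  = refl
mdfa-sum false true  true  false false = refl
mdfa-sum false true  true  false true  = refl
mdfa-sum false true  true  true  false = refl
mdfa-sum false true  true  true  true  = refl
mdfa-sum true  false false false false = refl
mdfa-sum true  false false false true  = refl
mdfa-sum true  false false true  false = refl
mdfa-sum true  false false true  true  = refl
mdfa-sum true  false true  false false = refl
mdfa-sum true  false true  false true  = refl
mdfa-sum true  false true  true  false = refl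
mdfa-sum true  false true  true  true  = refl
mdfa-sum true  true  false false false = refl
mdfa-sum true  true  false false true  = refl
mdfa-sum true  true  false true  false = refl
mdfa-sum true  true  false true  true  = refl
mdfa-sum true  true  true  false false = refl
mdfa-sum true  true  true  false true  = refl
mdfa-sum true  true  true  true  false = refl
mdfa-sum true  true  true  true  true  = refl

bit-zero : ∀ q → bit q 0 ≡ false
bit-zero zero    = refl
bit-zero (suc q) = bit-zero q

bit-lsb : ∀ b h → bit 0 (toℕ b + 2 * h) ≡ b
bit-lsb b h = begin
  (toℕ b + 2 * h) % 2 ≡ᵇ 1 ≡⟨ cong (λ m → (toℕ b + m) % 2 ≡ᵇ 1) (*-comm 2 h) ⟩
  (toℕ b + h * 2) % 2 ≡ᵇ 1 ≡⟨ cong (_≡ᵇ 1) ([m+kn]%n≡m%n (toℕ b) h 2) ⟩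
  toℕ b % 2 ≡ᵇ 1           ≡⟨ parity b ⟩
  b                        ∎
  where
  open ≡-Reasoning
  parity : ∀ b → (toℕ b % 2 ≡ᵇ 1) ≡ b
  parity false = refl
  parity true  = refl

bit-shift : ∀ q b h → bit (suc q) (toℕ b + 2 * h) ≡ bit q h
bit-shift q b h = cong (bit q) (begin
  (toℕ b + 2 * h) / 2   ≡⟨ +-distrib-/-∣ʳ (toℕ b) (divides h (*-comm 2 h)) ⟩
  toℕ b / 2 + 2 * h / 2 ≡⟨ cong₂ _+_ (half b) (trans (cong (_/ 2) (*-comm 2 h)) (m*n/n≡m h 2)) ⟩
  h                     ∎)
  where
  open ≡-Reasoning
  half : ∀ b → toℕ b / 2 ≡ 0
  half false = refl
  half true  = refl

n<2^n : ∀ n → n < 2 ^ n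
n<2^n zero    = s≤s z≤n
n<2^n (suc n) = +-mono-≤-< (m^n>0 2 n) (<-≤-trans (n<2^n n) (m≤m+n (2 ^ n) 0))

m*n≤o<m⇒n≡0 : ∀ {m n o} → m * n ≤ o → o < m → n ≡ 0
m*n≤o<m⇒n≡0 {n = zero}              _   _   = refl
m*n≤o<m⇒n≡0 {m} {n = suc n} {o} m*n≤o o<m =
  ⊥-elim (<-irrefl refl (<-≤-trans o<m (≤-trans (m≤m*n m (suc n)) m*n≤o)))

sum-tabulate : ∀ {n} (f : Fin n → ℕ) → Vec.sum (tabulate f) ≡ ∑[ i < n ] f i
sum-tabulate {zero}  f = refl
sum-tabulate {suc n} f = cong (f zero +_) (sum-tabulate (f ∘ suc))

∑-mono-≤ : ∀ {n} {f g : Fin n → ℕ} → (∀ i → f i ≤ g i) → ∑[ i < n ] f i ≤ ∑[ i < n ] g i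
∑-mono-≤ {zero}  f≤g = z≤n
∑-mono-≤ {suc n} f≤g = +-mono-≤ (f≤g zero) (∑-mono-≤ (f≤g ∘ suc))

∑-ones : ∀ n → ∑[ i < n ] 1 ≡ n
∑-ones zero    = refl
∑-ones (suc n) = cong suc (∑-ones n)

-- Seen from column p, an input of weight 2 ^ s has relativeWeight s p = 2 ^ (s ∸ p) and
-- isPending s p = 1 when p ≤ s; both are 0 when s < p.
relativeWeight : ℕ → ℕ → ℕ
relativeWeight s       zero    = 2 ^ s
relativeWeight zero    (suc p) = 0
relativeWeight (suc s) (suc p) = relativeWeight s p

isPending : ℕ → ℕ → ℕ
isPending s       zero    = 1
isPending zero    (suc p) = 0
isPending (suc s) (suc p) = isPending s p

relativeWeight-step : ∀ s p → relativeWeight s p ≡ toℕ (s ≡ᵇ p) + 2 * relativeWeight s (suc p)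
relativeWeight-step zero    zero    = refl
relativeWeight-step (suc s) zero    = refl
relativeWeight-step zero    (suc p) = refl
relativeWeight-step (suc s) (suc p) = relativeWeight-step s p

isPending-step : ∀ s p → isPending s p ≡ toℕ (s ≡ᵇ p) + isPending s (suc p)
isPending-step zero    zero    = refl
isPending-step (suc s) zero    = refl
isPending-step zero    (suc p) = refl
isPending-step (suc s) (suc p) = isPending-step s p

inputsAt : ∀ {n} → (Fin n → ℕ) → ℕ → List (Fin n)
inputsAt {zero}  s p = []
inputsAt {suc n} s p with s zero ≡ᵇ p
... | true  = zero ∷ map suc (inputsAt (s ∘ suc) p)
... | false = map suc (inputsAt (s ∘ suc) p)

sum-inputsAt : ∀ {n} (s : Fin n → ℕ) p (f : Fin n → ℕ) →
  sumₗ (map f (inputsAt s p)) ≡ ∑[ i < n ] (if s i ≡ᵇ p then f i else 0)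
sum-inputsAt {zero}  s p f = refl
sum-inputsAt {suc n} s p f with s zero ≡ᵇ p
... | true  = cong (f zero +_) tail-sum
  where
  tail-sum : sumₗ (map f (map suc (inputsAt (s ∘ suc) p)))
               ≡ ∑[ i < n ] (if s (suc i) ≡ᵇ p then f (suc i) else 0)
  tail-sum = trans (cong sumₗ (sym (map-∘ (inputsAt (s ∘ suc) p)))) (sum-inputsAt (s ∘ suc) p (f ∘ suc))
... | false = trans (cong sumₗ (sym (map-∘ (inputsAt (s ∘ suc) p)))) (sum-inputsAt (s ∘ suc) p (f ∘ suc))

length-inputsAt : ∀ {n} (s : Fin n → ℕ) p → length (inputsAt s p) ≡ ∑[ i < n ] toℕ (s i ≡ᵇ p)
length-inputsAt {zero}  s p = refl
length-inputsAt {suc n} s p with s zero ≡ᵇ p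
... | true  = cong suc (trans (length-map suc (inputsAt (s ∘ suc) p)) (length-inputsAt (s ∘ suc) p))
... | false = trans (length-map suc (inputsAt (s ∘ suc) p)) (length-inputsAt (s ∘ suc) p)

module _ {n : ℕ} (s : Fin n → ℕ) where

  pendingValue : ℕ → (Fin n → Bool) → ℕ
  pendingValue p x = ∑[ i < n ] (if x i then relativeWeight (s i) p else 0)

  pendingInputs : ℕ → ℕ
  pendingInputs p = ∑[ i < n ] isPending (s i) p

  pendingValue-step : ∀ p x →
    pendingValue p x ≡ sumₗ (map (toℕ ∘ x) (inputsAt s p)) + 2 * pendingValue (suc p) x
  pendingValue-step p x = begin
    pendingValue p x
      ≡⟨ sum-cong-≗ (λ i → split (x i) (s i)) ⟩
    ∑[ i < n ] (here i + 2 * later i)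
      ≡⟨ ∑-distrib-+ here (λ i → 2 * later i) ⟩
    ∑[ i < n ] here i + ∑[ i < n ] (2 * later i)
      ≡⟨ cong₂ _+_ (sym (sum-inputsAt s p (toℕ ∘ x))) (sym (*-distribˡ-sum 2 later)) ⟩
    sumₗ (map (toℕ ∘ x) (inputsAt s p)) + 2 * pendingValue (suc p) x ∎
    where
    open ≡-Reasoning
    here : Fin n → ℕ
    here i = if s i ≡ᵇ p then toℕ (x i) else 0
    later : Fin n → ℕ
    later i = if x i then relativeWeight (s i) (suc p) else 0
    split : ∀ b t → (if b then relativeWeight t p else 0)
                      ≡ (if t ≡ᵇ p then toℕ b else 0) + 2 * (if b then relativeWeight t (suc p) else 0)
    split true  t = relativeWeight-step t p
    split false t with t ≡ᵇ p
    ... | true  = refl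
    ... | false = refl

  pendingInputs-step : ∀ p → pendingInputs p ≡ length (inputsAt s p) + pendingInputs (suc p)
  pendingInputs-step p = begin
    pendingInputs p
      ≡⟨ sum-cong-≗ (λ i → isPending-step (s i) p) ⟩
    ∑[ i < n ] (toℕ (s i ≡ᵇ p) + isPending (s i) (suc p))
      ≡⟨ ∑-distrib-+ (λ i → toℕ (s i ≡ᵇ p)) (λ i → isPending (s i) (suc p)) ⟩
    ∑[ i < n ] toℕ (s i ≡ᵇ p) + pendingInputs (suc p)
      ≡⟨ cong (_+ pendingInputs (suc p)) (sym (length-inputsAt s p)) ⟩
    length (inputsAt s p) + pendingInputs (suc p) ∎
    where open ≡-Reasoning

count : ∀ {A : Set} → Maybe A → ℕ
count nothing  = 0
count (just _) = 1

count-map : ∀ {A B : Set} (f : A → B) o → count (mapMaybe f o) ≡ count o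
count-map f nothing  = refl
count-map f (just _) = refl

justs : ∀ {A : Set} → List (Maybe A) → ℕ
justs os = sumₗ (map count os)

nth : ∀ {A : Set} → List (Maybe A) → ℕ → Maybe A
nth []       q       = nothing
nth (o ∷ os) zero    = o
nth (o ∷ os) (suc q) = nth os q

nth-∷ : ∀ {A : Set} (o : Maybe A) os {q} → 0 < q → nth (o ∷ os) q ≡ nth os (pred q)
nth-∷ o os {suc q} _ = refl

increasing-≤-justs : ∀ {A : Set} (os : List (Maybe A)) {m} (t : Fin m → ℕ) →
  (∀ i j → i <ᶠ j → t i < t j) → (∀ j → Is-just (nth os (t j))) → m ≤ justs os
increasing-≤-justs os             {zero}  t increasing occurs = z≤n
increasing-≤-justs []             {suc m} t increasing occurs with occurs zero
... | ()
increasing-≤-justs (nothing ∷ os) {m}     t increasing occurs =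
  increasing-≤-justs os (pred ∘ t)
    (λ i j i<j → pred-mono-< {{>-nonZero (positive i)}} (increasing i j i<j))
    (λ j → subst Is-just (nth-∷ nothing os (positive j)) (occurs j))
  where
  positive : ∀ j → 0 < t j
  positive j with t j | occurs j
  ... | zero  | ()
  ... | suc _ | _ = s≤s z≤n
increasing-≤-justs (just a ∷ os)  {suc m} t increasing occurs =
  s≤s (increasing-≤-justs os (pred ∘ t ∘ suc)
    (λ i j i<j → pred-mono-< {{>-nonZero (positive i)}} (increasing (suc i) (suc j) (s≤s i<j)))
    (λ j → subst Is-just (nth-∷ (just a) os (positive j)) (occurs (suc j))))
  where
  positive : ∀ j → 0 < t (suc j)
  positive j = ≤-<-trans z≤n (increasing zero (suc j) (s≤s z≤n))

-- Circuits under construction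

module _ {n : ℕ} where

  Node : ℕ → Set
  Node k = Fin (k + (2 + n))

  Pair : ℕ → Set
  Pair k = Node k × Node k

  value : ∀ {k} → Gates n k → (Fin n → Bool) → Node k → Bool
  value c x i = lookup (eval c x) i

  falseNode : ∀ k → Node k
  falseNode k = k ↑ʳ 0F

  inputNode : ∀ k → Fin n → Node k
  inputNode k i = k ↑ʳ suc (suc i)

  value-↑ʳ : ∀ {k} (c : Gates n k) x j → value c x (k ↑ʳ j) ≡ value [] x j
  value-↑ʳ []      x j = refl
  value-↑ʳ (c ▹ g) x j = value-↑ʳ c x j

  value-falseNode : ∀ {k} (c : Gates n k) x → value c x (falseNode k) ≡ false
  value-falseNode c x = value-↑ʳ c x 0F

  value-inputNode : ∀ {k} (c : Gates n k) x i → value c x (inputNode k i) ≡ x i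
  value-inputNode c x i = trans (value-↑ʳ c x (suc (suc i))) (lookup∘tabulate x i)

  infix 4 _⊑_
  data _⊑_ : ∀ {k k′} → Gates n k → Gates n k′ → Set where
    ⊑-refl : ∀ {k} {c : Gates n k} → c ⊑ c
    ⊑-step : ∀ {k k′} {c : Gates n k} {c′ : Gates n k′} {g : Gate (k′ + (2 + n))} →
             c ⊑ c′ → c ⊑ c′ ▹ g

  ⊑-trans : ∀ {k k′ k″} {c : Gates n k} {c′ : Gates n k′} {c″ : Gates n k″} →
            c ⊑ c′ → c′ ⊑ c″ → c ⊑ c″
  ⊑-trans e ⊑-refl      = e
  ⊑-trans e (⊑-step e′) = ⊑-step (⊑-trans e e′)

  ⊑-▹ : ∀ {k} {c : Gates n k} {g : Gate (k + (2 + n))} → c ⊑ c ▹ g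
  ⊑-▹ = ⊑-step ⊑-refl

  lift : ∀ {k k′} {c : Gates n k} {c′ : Gates n k′} → c ⊑ c′ → Node k → Node k′
  lift ⊑-refl     i = i
  lift (⊑-step e) i = suc (lift e i)

  liftPair : ∀ {k k′} {c : Gates n k} {c′ : Gates n k′} → c ⊑ c′ → Pair k → Pair k′
  liftPair e (u , w) = lift e u , lift e w

  value-lift : ∀ {k k′} {c : Gates n k} {c′ : Gates n k′} (e : c ⊑ c′) x i →
               value c′ x (lift e i) ≡ value c x i
  value-lift ⊑-refl     x i = refl
  value-lift (⊑-step e) x i = value-lift e x i

  singleValue : ∀ {k} → Gates n k → (Fin n → Bool) → Node k → ℕ
  singleValue c x i = toℕ (value c x i)

  pairValue : ∀ {k} → Gates n k → (Fin n → Bool) → Pair k → ℕ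
  pairValue c x (u , w) = decodePair (value c x u) (value c x w)

  outputValue : ∀ {k} → Gates n k → (Fin n → Bool) → Maybe (Node k) → ℕ
  outputValue c x nothing  = 0
  outputValue c x (just i) = singleValue c x i

  singlesValue : ∀ {k} → Gates n k → (Fin n → Bool) → List (Node k) → ℕ
  singlesValue c x S = sumₗ (map (singleValue c x) S)

  pairsValue : ∀ {k} → Gates n k → (Fin n → Bool) → List (Pair k) → ℕ
  pairsValue c x P = sumₗ (map (pairValue c x) P)

  singleValue-lift : ∀ {k k′} {c : Gates n k} {c′ : Gates n k′} (e : c ⊑ c′) x i →
                     singleValue c′ x (lift e i) ≡ singleValue c x i
  singleValue-lift e x i = cong toℕ (value-lift e x i)

  pairValue-lift : ∀ {k k′} {c : Gates n k} {c′ : Gates n k′} (e : c ⊑ c′) x p →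
                   pairValue c′ x (liftPair e p) ≡ pairValue c x p
  pairValue-lift e x (u , w) = cong₂ decodePair (value-lift e x u) (value-lift e x w)

  outputValue-lift : ∀ {k k′} {c : Gates n k} {c′ : Gates n k′} (e : c ⊑ c′) x o →
                     outputValue c′ x (mapMaybe (lift e) o) ≡ outputValue c x o
  outputValue-lift e x nothing  = refl
  outputValue-lift e x (just i) = singleValue-lift e x i

  pairsValue-lift : ∀ {k k′} {c : Gates n k} {c′ : Gates n k′} (e : c ⊑ c′) x P →
                    pairsValue c′ x (map (liftPair e) P) ≡ pairsValue c x P
  pairsValue-lift e x P =
    cong sumₗ (trans (sym (map-∘ P)) (map-cong (pairValue-lift e x) P))

  fullAdder : ∀ {k} → Gates n k → Node k → Pair k → Gates n (4 + k)
  fullAdder c z (u , w) =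
    c ▹ (_xor_ , z , w)
      ▹ (_xor_ , 1 ↑ʳ z , 1 ↑ʳ u)
      ▹ (_∧_ , 2 ↑ʳ w , 0F)
      ▹ (_xor_ , 3 ↑ʳ u , 0F)

  ⊑-fullAdder : ∀ {k} {c : Gates n k} {z p} → c ⊑ fullAdder c z p
  ⊑-fullAdder = ⊑-step (⊑-step (⊑-step ⊑-▹))

  fullAdder-value : ∀ {k} (c : Gates n k) x z p →
    singleValue c x z + pairValue c x p
      ≡ singleValue (fullAdder c z p) x 3F + 2 * singleValue (fullAdder c z p) x 0F
  fullAdder-value c x z (u , w) = fullAdder-sum (value c x z) (value c x u) (value c x w)

  mdfa : ∀ {k} → Gates n k → Node k → Pair k → Pair k → Gates n (8 + k)
  mdfa c z (u₁ , w₁) (u₂ , w₂) =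
    c ▹ (_xor_ , z , w₁)
      ▹ (_xor_ , 0F , 1 ↑ʳ w₂)
      ▹ (_xor_ , 2 ↑ʳ z , 2 ↑ʳ u₁)
      ▹ (_∨_ , 3 ↑ʳ w₁ , 0F)
      ▹ (_xor_ , 3F , 4 ↑ʳ u₂)
      ▹ ((λ a b → not a ∧ b) , 5 ↑ʳ w₂ , 0F)
      ▹ (_xor_ , 5F , 0F)
      ▹ (_xor_ , 3F , 1F)

  ⊑-mdfa : ∀ {k} {c : Gates n k} {z p q} → c ⊑ mdfa c z p q
  ⊑-mdfa = ⊑-step (⊑-step (⊑-step (⊑-step (⊑-step (⊑-step (⊑-step ⊑-▹))))))

  mdfa-value : ∀ {k} (c : Gates n k) x z p q →
    singleValue c x z + pairValue c x p + pairValue c x q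
      ≡ singleValue (mdfa c z p q) x 6F + 2 * pairValue (mdfa c z p q) x (1F , 0F)
  mdfa-value c x z (u₁ , w₁) (u₂ , w₂) =
    mdfa-sum (value c x z) (value c x u₁) (value c x w₁) (value c x u₂) (value c x w₂)

  -- Summing one column

  record Column (k : ℕ) : Set where
    constructor column
    field
      singles : List (Node k)
      pairs   : List (Pair k)

  open Column public

  columnValue : ∀ {k} → Gates n k → (Fin n → Bool) → Column k → ℕ
  columnValue c x (column S P) = singlesValue c x S + pairsValue c x P

  -- Budgets are doubled to stay in ℕ: a gate costs 2, while a single, a pair
  -- and a finished output bit are worth 9, 16 and 4.
  columnCost : ∀ {k} → Column k → ℕ
  columnCost (column S P) = 9 * length S + 16 * length P

  record Grown {k} (c : Gates n k) (A : ℕ → Set) : Set where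
    constructor grow
    field
      {size′} : ℕ
      circuit : Gates n size′
      extends : c ⊑ circuit
      result  : A size′

  open Grown public

  rebase : ∀ {k k₁} {c : Gates n k} {c₁ : Gates n k₁} {A : ℕ → Set} →
           c ⊑ c₁ → Grown c₁ A → Grown c A
  rebase e (grow c′ e′ r) = grow c′ (⊑-trans e e′) r

  Compressed : ℕ → Set
  Compressed k = Maybe (Node k) × Column k

  compressedValue : ∀ {k} → Gates n k → (Fin n → Bool) → Compressed k → ℕ
  compressedValue c x (o , carry) = outputValue c x o + 2 * columnValue c x carry

  compressedCost : ∀ {k} → Compressed k → ℕ
  compressedCost (o , carry) = 4 * count o + columnCost carry

  grownValue : ∀ {k} {c : Gates n k} → Grown c Compressed → (Fin n → Bool) → ℕ
  grownValue r x = compressedValue (circuit r) x (result r)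

  grownCost : ∀ {k} {c : Gates n k} → Grown c Compressed → ℕ
  grownCost r = 2 * size′ r + compressedCost (result r)

  -- The pairs live in an earlier circuit c₀ and are lifted only when used, which keeps
  -- the recursion structural.
  addPairs : ∀ {k₀ k} (c₀ : Gates n k₀) → List (Pair k₀) → (c : Gates n k) → c₀ ⊑ c →
             Node k → Grown c Compressed
  addPairs c₀ []          c e z = grow c ⊑-refl (just z , column [] [])
  addPairs c₀ (p ∷ [])    c e z =
    grow (fullAdder c z (liftPair e p)) ⊑-fullAdder (just 3F , column (0F ∷ []) [])
  addPairs c₀ (p ∷ q ∷ P) c e z =
    let grow c′ e′ (o , column S P′) =
          addPairs c₀ P (mdfa c z (liftPair e p) (liftPair e q)) (⊑-trans e ⊑-mdfa) 6F
    in  grow c′ (⊑-trans ⊑-mdfa e′) (o , column S (liftPair e′ (1F , 0F) ∷ P′))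

  addPairs-value : ∀ {k₀ k} (c₀ : Gates n k₀) P (c : Gates n k) (e : c₀ ⊑ c) z x →
    singleValue c x z + pairsValue c₀ x P ≡ grownValue (addPairs c₀ P c e z) x
  addPairs-value c₀ []          c e z x = refl
  addPairs-value c₀ (p ∷ [])    c e z x = begin
    singleValue c x z + (pairValue c₀ x p + 0)
      ≡⟨ cong (singleValue c x z +_) (trans (+-identityʳ _) (sym (pairValue-lift e x p))) ⟩
    singleValue c x z + pairValue c x (liftPair e p)
      ≡⟨ fullAdder-value c x z (liftPair e p) ⟩
    singleValue c₁ x 3F + 2 * singleValue c₁ x 0F
      ≡⟨ cong (λ v → singleValue c₁ x 3F + 2 * v)
              (sym (trans (+-identityʳ _) (+-identityʳ (singleValue c₁ x 0F)))) ⟩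
    singleValue c₁ x 3F + 2 * (singleValue c₁ x 0F + 0 + 0) ∎
    where
    open ≡-Reasoning
    c₁ = fullAdder c z (liftPair e p)
  addPairs-value c₀ (p ∷ q ∷ P) c e z x = begin
    Z + (pairValue c₀ x p + (pairValue c₀ x q + V))
      ≡⟨ reassociate Z (pairValue c₀ x p) (pairValue c₀ x q) V ⟩
    Z + pairValue c₀ x p + pairValue c₀ x q + V
      ≡⟨ cong (_+ V) inputs ⟩
    singleValue c₁ x 6F + 2 * U + V
      ≡⟨ +-comm-last (singleValue c₁ x 6F) (2 * U) V ⟩
    singleValue c₁ x 6F + V + 2 * U
      ≡⟨ cong (_+ 2 * U) (addPairs-value c₀ P c₁ (⊑-trans e ⊑-mdfa) 6F x) ⟩
    O + 2 * (CS + CP) + 2 * U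
      ≡⟨ regroup O CS CP U ⟩
    O + 2 * (CS + (U + CP))
      ≡⟨ cong (λ u → O + 2 * (CS + (u + CP))) (sym (pairValue-lift (extends r) x (1F , 0F))) ⟩
    grownValue (addPairs c₀ (p ∷ q ∷ P) c e z) x ∎
    where
    open ≡-Reasoning
    c₁ = mdfa c z (liftPair e p) (liftPair e q)
    r = addPairs c₀ P c₁ (⊑-trans e ⊑-mdfa) 6F
    Z = singleValue c x z
    V = pairsValue c₀ x P
    U = pairValue c₁ x (1F , 0F)
    O = outputValue (circuit r) x (proj₁ (result r))
    CS = singlesValue (circuit r) x (singles (proj₂ (result r)))
    CP = pairsValue (circuit r) x (pairs (proj₂ (result r)))
    inputs : Z + pairValue c₀ x p + pairValue c₀ x q ≡ singleValue c₁ x 6F + 2 * U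
    inputs = trans (cong₂ (λ a b → Z + a + b) (sym (pairValue-lift e x p)) (sym (pairValue-lift e x q)))
                   (mdfa-value c x z (liftPair e p) (liftPair e q))
    reassociate : ∀ a b c d → a + (b + (c + d)) ≡ a + b + c + d
    reassociate = solve-∀
    +-comm-last : ∀ a b c → a + b + c ≡ a + c + b
    +-comm-last = solve-∀
    regroup : ∀ o s p u → o + 2 * (s + p) + 2 * u ≡ o + 2 * (s + (u + p))
    regroup = solve-∀

  -- The single z is charged only 5 of its 9; the spare 4 pays for the half adder
  -- that starts a chain without a single in compressPairs.
  addPairs-cost : ∀ {k₀ k} (c₀ : Gates n k₀) P (c : Gates n k) (e : c₀ ⊑ c) z →
    grownCost (addPairs c₀ P c e z) ≤ 2 * k + 5 + 16 * length P
  addPairs-cost {k = k} c₀ []          c e z =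
    ≤-trans (+-monoʳ-≤ (2 * k) (n≤1+n 4)) (m≤m+n (2 * k + 5) 0)
  addPairs-cost {k = k} c₀ (p ∷ [])    c e z = ≤-reflexive (fullAdder-cost k)
    where
    fullAdder-cost : ∀ k → 2 * (4 + k) + 13 ≡ 2 * k + 5 + 16 * 1
    fullAdder-cost = solve-∀
  addPairs-cost {k = k} c₀ (p ∷ q ∷ P) c e z = begin
    grownCost (addPairs c₀ (p ∷ q ∷ P) c e z)
      ≡⟨ carry-pair (2 * size′ r) (4 * count o) (length S) (length P′) ⟩
    grownCost r + 16
      ≤⟨ +-monoˡ-≤ 16 (addPairs-cost c₀ P c₁ (⊑-trans e ⊑-mdfa) 6F) ⟩
    2 * (8 + k) + 5 + 16 * length P + 16
      ≡⟨ mdfa-cost k (length P) ⟩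
    2 * k + 5 + 16 * length (p ∷ q ∷ P) ∎
    where
    open ≤-Reasoning
    c₁ = mdfa c z (liftPair e p) (liftPair e q)
    r = addPairs c₀ P c₁ (⊑-trans e ⊑-mdfa) 6F
    o = proj₁ (result r)
    S = singles (proj₂ (result r))
    P′ = pairs (proj₂ (result r))
    carry-pair : ∀ g o s p → g + (o + (9 * s + 16 * suc p)) ≡ g + (o + (9 * s + 16 * p)) + 16
    carry-pair = solve-∀
    mdfa-cost : ∀ k l → 2 * (8 + k) + 5 + 16 * l + 16 ≡ 2 * k + 5 + 16 * (2 + l)
    mdfa-cost = solve-∀

  Paired : ℕ → Set
  Paired k = Maybe (Node k) × List (Pair k)

  pairedValue : ∀ {k} → Gates n k → (Fin n → Bool) → Paired k → ℕ
  pairedValue c x (o , P) = outputValue c x o + pairsValue c x P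

  pairedCost : ∀ {k} → Paired k → ℕ
  pairedCost (o , P) = 9 * count o + 16 * length P

  pairUp : ∀ {k₀ k} (c₀ : Gates n k₀) → List (Node k₀) → (c : Gates n k) → c₀ ⊑ c → Grown c Paired
  pairUp c₀ []          c e = grow c ⊑-refl (nothing , [])
  pairUp c₀ (a ∷ [])    c e = grow c ⊑-refl (just (lift e a) , [])
  pairUp c₀ (a ∷ b ∷ S) c e =
    let grow c′ e′ (o , P) = pairUp c₀ S (c ▹ (_xor_ , lift e a , lift e b)) (⊑-step e)
    in  grow c′ (⊑-trans ⊑-▹ e′) (o , liftPair e′ (1 ↑ʳ lift e a , 0F) ∷ P)

  pairUp-value : ∀ {k₀ k} (c₀ : Gates n k₀) S (c : Gates n k) (e : c₀ ⊑ c) x →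
    let r = pairUp c₀ S c e in singlesValue c₀ x S ≡ pairedValue (circuit r) x (result r)
  pairUp-value c₀ []          c e x = refl
  pairUp-value c₀ (a ∷ [])    c e x = cong (_+ 0) (sym (singleValue-lift e x a))
  pairUp-value c₀ (a ∷ b ∷ S) c e x = begin
    A + (B + singlesValue c₀ x S)     ≡⟨ sym (+-assoc A B _) ⟩
    A + B + singlesValue c₀ x S       ≡⟨ cong₂ _+_ (sym paired) (pairUp-value c₀ S c₁ (⊑-step e) x) ⟩
    U + (O + PP)                      ≡⟨ +-comm-first U O PP ⟩
    O + (U + PP)                      ≡⟨ cong (λ u → O + (u + PP)) (sym (pairValue-lift (extends r) x _)) ⟩
    pairedValue (circuit (pairUp c₀ (a ∷ b ∷ S) c e)) x (result (pairUp c₀ (a ∷ b ∷ S) c e)) ∎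
    where
    open ≡-Reasoning
    c₁ = c ▹ (_xor_ , lift e a , lift e b)
    r = pairUp c₀ S c₁ (⊑-step e)
    A = singleValue c₀ x a
    B = singleValue c₀ x b
    U = pairValue c₁ x (1 ↑ʳ lift e a , 0F)
    O = outputValue (circuit r) x (proj₁ (result r))
    PP = pairsValue (circuit r) x (proj₂ (result r))
    paired : U ≡ A + B
    paired = trans (xor-decodePair (value c x (lift e a)) (value c x (lift e b)))
                   (cong₂ _+_ (singleValue-lift e x a) (singleValue-lift e x b))
    +-comm-first : ∀ u o p → u + (o + p) ≡ o + (u + p)
    +-comm-first = solve-∀

  pairUp-cost : ∀ {k₀ k} (c₀ : Gates n k₀) S (c : Gates n k) (e : c₀ ⊑ c) →
    let r = pairUp c₀ S c e in 2 * size′ r + pairedCost (result r) ≤ 2 * k + 9 * length S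
  pairUp-cost c₀ []          c e = ≤-refl
  pairUp-cost c₀ (a ∷ [])    c e = ≤-refl
  pairUp-cost {k = k} c₀ (a ∷ b ∷ S) c e = begin
    2 * size′ r + (9 * count o + 16 * suc (length P))  ≡⟨ new-pair (2 * size′ r) (count o) (length P) ⟩
    2 * size′ r + (9 * count o + 16 * length P) + 16  ≤⟨ +-monoˡ-≤ 16 (pairUp-cost c₀ S c₁ (⊑-step e)) ⟩
    2 * suc k + 9 * length S + 16                     ≡⟨ xor-cost k (length S) ⟩
    2 * k + 9 * length (a ∷ b ∷ S)                    ∎
    where
    open ≤-Reasoning
    c₁ = c ▹ (_xor_ , lift e a , lift e b)
    r = pairUp c₀ S c₁ (⊑-step e)
    o = proj₁ (result r)
    P = proj₂ (result r)
    new-pair : ∀ g o p → g + (9 * o + 16 * suc p) ≡ g + (9 * o + 16 * p) + 16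
    new-pair = solve-∀
    xor-cost : ∀ k s → 2 * suc k + 9 * s + 16 ≡ 2 * k + 9 * (2 + s)
    xor-cost = solve-∀

  -- Without a single to start the chain, the half adder u ∧ ¬w rewrites the first
  -- pair (u , w) as w + 2 (u ∧ ¬w); then w starts the chain.
  compressPairs : ∀ {k} (c : Gates n k) → Paired k → Grown c Compressed
  compressPairs c (just z  , P)           = addPairs c P c ⊑-refl z
  compressPairs c (nothing , [])          = grow c ⊑-refl (nothing , column [] [])
  compressPairs c (nothing , (u , w) ∷ P) =
    let grow c′ e′ (o , column S P′) = addPairs c P (c ▹ ((λ a b → a ∧ not b) , u , w)) ⊑-▹ (1 ↑ʳ w)
    in  grow c′ (⊑-trans ⊑-▹ e′) (o , column (lift e′ 0F ∷ S) P′)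

  compressPairs-value : ∀ {k} (c : Gates n k) op x →
    pairedValue c x op ≡ grownValue (compressPairs c op) x
  compressPairs-value c (just z  , P)           x = addPairs-value c P c ⊑-refl z x
  compressPairs-value c (nothing , [])          x = refl
  compressPairs-value c (nothing , (u , w) ∷ P) x = begin
    pairValue c x (u , w) + V     ≡⟨ cong (_+ V) (halfAdder-decodePair (value c x u) (value c x w)) ⟩
    W + 2 * H + V                 ≡⟨ +-comm-last W (2 * H) V ⟩
    W + V + 2 * H                 ≡⟨ cong (_+ 2 * H) (addPairs-value c P c₁ ⊑-▹ (1 ↑ʳ w) x) ⟩
    O + 2 * (CS + CP) + 2 * H     ≡⟨ regroup O CS CP H ⟩
    O + 2 * (H + CS + CP)         ≡⟨ cong (λ h → O + 2 * (h + CS + CP)) (sym (singleValue-lift (extends r) x 0F)) ⟩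
    grownValue (compressPairs c (nothing , (u , w) ∷ P)) x ∎
    where
    open ≡-Reasoning
    c₁ = c ▹ ((λ a b → a ∧ not b) , u , w)
    r = addPairs c P c₁ ⊑-▹ (1 ↑ʳ w)
    V = pairsValue c x P
    W = singleValue c x w
    H = singleValue c₁ x 0F
    O = outputValue (circuit r) x (proj₁ (result r))
    CS = singlesValue (circuit r) x (singles (proj₂ (result r)))
    CP = pairsValue (circuit r) x (pairs (proj₂ (result r)))
    +-comm-last : ∀ a b c → a + b + c ≡ a + c + b
    +-comm-last = solve-∀
    regroup : ∀ o s p h → o + 2 * (s + p) + 2 * h ≡ o + 2 * (h + s + p)
    regroup = solve-∀

  compressPairs-cost : ∀ {k} (c : Gates n k) op → grownCost (compressPairs c op) ≤ 2 * k + pairedCost op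
  compressPairs-cost {k} c (just z  , P)           =
    ≤-trans (addPairs-cost c P c ⊑-refl z)
      (≤-trans (+-monoˡ-≤ (16 * length P) (+-monoʳ-≤ (2 * k) (m≤m+n 5 4)))
               (≤-reflexive (+-assoc (2 * k) 9 _)))
  compressPairs-cost {k} c (nothing , [])          = ≤-refl
  compressPairs-cost {k} c (nothing , (u , w) ∷ P) = begin
    grownCost (compressPairs c (nothing , (u , w) ∷ P))
      ≡⟨ carry-single (2 * size′ r) (4 * count o) (length S) (length P′) ⟩
    grownCost r + 9
      ≤⟨ +-monoˡ-≤ 9 (addPairs-cost c P c₁ ⊑-▹ (1 ↑ʳ w)) ⟩
    2 * suc k + 5 + 16 * length P + 9
      ≡⟨ halfAdder-cost k (length P) ⟩
    2 * k + 16 * suc (length P) ∎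
    where
    open ≤-Reasoning
    c₁ = c ▹ ((λ a b → a ∧ not b) , u , w)
    r = addPairs c P c₁ ⊑-▹ (1 ↑ʳ w)
    o = proj₁ (result r)
    S = singles (proj₂ (result r))
    P′ = pairs (proj₂ (result r))
    carry-single : ∀ g o s p → g + (o + (9 * suc s + 16 * p)) ≡ g + (o + (9 * s + 16 * p)) + 9
    carry-single = solve-∀
    halfAdder-cost : ∀ k p → 2 * suc k + 5 + 16 * p + 9 ≡ 2 * k + 16 * suc p
    halfAdder-cost = solve-∀

  compressColumn : ∀ {k} (c : Gates n k) → Column k → Grown c Compressed
  compressColumn c (column S P) =
    let grow c₁ e₁ (o , P₁) = pairUp c S c ⊑-refl
    in  rebase e₁ (compressPairs c₁ (o , P₁ ++ map (liftPair e₁) P))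

  sumₗ-map-++ : ∀ {A : Set} (f : A → ℕ) xs ys →
                sumₗ (map f (xs ++ ys)) ≡ sumₗ (map f xs) + sumₗ (map f ys)
  sumₗ-map-++ f xs ys = trans (cong sumₗ (map-++ f xs ys)) (sum-++ (map f xs) (map f ys))

  compressColumn-value : ∀ {k} (c : Gates n k) col x →
    columnValue c x col ≡ grownValue (compressColumn c col) x
  compressColumn-value c (column S P) x = begin
    singlesValue c x S + pairsValue c x P
      ≡⟨ cong (_+ pairsValue c x P) (pairUp-value c S c ⊑-refl x) ⟩
    O + PP₁ + pairsValue c x P
      ≡⟨ +-assoc O PP₁ _ ⟩
    O + (PP₁ + pairsValue c x P)
      ≡⟨ cong (λ v → O + (PP₁ + v)) (sym (pairsValue-lift (extends r) x P)) ⟩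
    O + (PP₁ + pairsValue c₁ x (map (liftPair (extends r)) P))
      ≡⟨ cong (O +_) (sym (sumₗ-map-++ (pairValue c₁ x) P₁ _)) ⟩
    pairedValue c₁ x (proj₁ (result r) , P₁ ++ map (liftPair (extends r)) P)
      ≡⟨ compressPairs-value c₁ (proj₁ (result r) , P₁ ++ map (liftPair (extends r)) P) x ⟩
    grownValue (compressColumn c (column S P)) x ∎
    where
    open ≡-Reasoning
    r = pairUp c S c ⊑-refl
    c₁ = circuit r
    P₁ = proj₂ (result r)
    O = outputValue c₁ x (proj₁ (result r))
    PP₁ = pairsValue c₁ x P₁

  compressColumn-cost : ∀ {k} (c : Gates n k) col → grownCost (compressColumn c col) ≤ 2 * k + columnCost col
  compressColumn-cost {k} c (column S P) = begin
    grownCost (compressColumn c (column S P))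
      ≤⟨ compressPairs-cost c₁ (o , P₁ ++ map (liftPair (extends r)) P) ⟩
    2 * size′ r + (9 * count o + 16 * length (P₁ ++ map (liftPair (extends r)) P))
      ≡⟨ cong (λ l → 2 * size′ r + (9 * count o + 16 * l))
              (trans (length-++ P₁) (cong (length P₁ +_) (length-map _ P))) ⟩
    2 * size′ r + (9 * count o + 16 * (length P₁ + length P))
      ≡⟨ split-pairs (2 * size′ r) (count o) (length P₁) (length P) ⟩
    2 * size′ r + pairedCost (result r) + 16 * length P
      ≤⟨ +-monoˡ-≤ (16 * length P) (pairUp-cost c S c ⊑-refl) ⟩
    2 * k + 9 * length S + 16 * length P
      ≡⟨ +-assoc (2 * k) _ _ ⟩
    2 * k + columnCost (column S P) ∎
    where
    open ≤-Reasoning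
    r = pairUp c S c ⊑-refl
    c₁ = circuit r
    o = proj₁ (result r)
    P₁ = proj₂ (result r)
    split-pairs : ∀ g o p q → g + (9 * o + 16 * (p + q)) ≡ g + (9 * o + 16 * p) + 16 * q
    split-pairs = solve-∀

  -- Summing all columns

  record Processed (k : ℕ) : Set where
    constructor processed
    field
      bits     : List (Maybe (Node k))
      leftover : Column k

  open Processed public

  -- Sums the columns p, p + 1, …, p + f − 1; column p receives the carries of column
  -- p − 1 together with the inputs of weight 2 ^ p.
  process : (Fin n → ℕ) → ℕ → ℕ → ∀ {k} (c : Gates n k) → Column k → Grown c Processed
  process s zero    p     c col          = grow c ⊑-refl (processed [] col)
  process s (suc f) p {k} c (column S P) =
    let grow c₁ e₁ (o , carry)          = compressColumn c (column (S ++ map (inputNode k) (inputsAt s p)) P)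
        grow c₂ e₂ (processed os rest) = process s f (suc p) c₁ carry
    in  grow c₂ (⊑-trans e₁ e₂) (processed (mapMaybe (lift e₂) o ∷ os) rest)

  binaryValue : ∀ {k} → Gates n k → (Fin n → Bool) → List (Maybe (Node k)) → ℕ → ℕ
  binaryValue c x []       y = y
  binaryValue c x (o ∷ os) y = outputValue c x o + 2 * binaryValue c x os y

  singlesValue-inputs : ∀ {k} (c : Gates n k) x (L : List (Fin n)) →
    singlesValue c x (map (inputNode k) L) ≡ sumₗ (map (toℕ ∘ x) L)
  singlesValue-inputs c x L =
    cong sumₗ (trans (sym (map-∘ L)) (map-cong (cong toℕ ∘ value-inputNode c x) L))

  process-value : ∀ s f p {k} (c : Gates n k) col x →
    let r = process s f p c col in
    columnValue c x col + pendingValue s p x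
      ≡ binaryValue (circuit r) x (bits (result r))
          (columnValue (circuit r) x (leftover (result r)) + pendingValue s (f + p) x)
  process-value s zero    p     c col          x = refl
  process-value s (suc f) p {k} c (column S P) x = begin
    singlesValue c x S + pairsValue c x P + pendingValue s p x
      ≡⟨ cong (singlesValue c x S + pairsValue c x P +_) pending-step ⟩
    singlesValue c x S + pairsValue c x P + (singlesValue c x L + 2 * Y)
      ≡⟨ regroup₁ (singlesValue c x S) (pairsValue c x P) (singlesValue c x L) Y ⟩
    singlesValue c x S + singlesValue c x L + pairsValue c x P + 2 * Y
      ≡⟨ cong (λ v → v + pairsValue c x P + 2 * Y) (sym (sumₗ-map-++ (singleValue c x) S L)) ⟩
    columnValue c x (column (S ++ L) P) + 2 * Y
      ≡⟨ cong (_+ 2 * Y) (compressColumn-value c (column (S ++ L) P) x) ⟩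
    O + 2 * columnValue c₁ x carry + 2 * Y
      ≡⟨ regroup₂ O (columnValue c₁ x carry) Y ⟩
    O + 2 * (columnValue c₁ x carry + Y)
      ≡⟨ cong (λ v → O + 2 * v) (process-value s f (suc p) c₁ carry x) ⟩
    O + 2 * binaryValue c₂ x os (columnValue c₂ x rest + pendingValue s (f + suc p) x)
      ≡⟨ cong₂ (λ a q → a + 2 * binaryValue c₂ x os (columnValue c₂ x rest + pendingValue s q x))
               (sym (outputValue-lift (extends r₂) x o)) (+-suc f p) ⟩
    binaryValue c₂ x (mapMaybe (lift (extends r₂)) o ∷ os)
      (columnValue c₂ x rest + pendingValue s (suc f + p) x) ∎
    where
    open ≡-Reasoning
    L = map (inputNode k) (inputsAt s p)
    Y = pendingValue s (suc p) x
    r₁ = compressColumn c (column (S ++ L) P)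
    c₁ = circuit r₁
    O = outputValue c₁ x (proj₁ (result r₁))
    carry = proj₂ (result r₁)
    r₂ = process s f (suc p) c₁ carry
    c₂ = circuit r₂
    o = proj₁ (result r₁)
    os = bits (result r₂)
    rest = leftover (result r₂)
    pending-step : pendingValue s p x ≡ singlesValue c x L + 2 * Y
    pending-step = trans (pendingValue-step s p x) (cong (_+ 2 * Y) (sym (singlesValue-inputs c x (inputsAt s p))))
    regroup₁ : ∀ a b c y → a + b + (c + 2 * y) ≡ a + c + b + 2 * y
    regroup₁ = solve-∀
    regroup₂ : ∀ o v y → o + 2 * v + 2 * y ≡ o + 2 * (v + y)
    regroup₂ = solve-∀

  process-cost : ∀ s f p {k} (c : Gates n k) col →
    let r = process s f p c col in
    2 * size′ r + 4 * justs (bits (result r)) + columnCost (leftover (result r)) + 9 * pendingInputs s (f + p)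
      ≤ 2 * k + columnCost col + 9 * pendingInputs s p
  process-cost s zero    p {k} c col          =
    ≤-reflexive (cong (λ g → g + columnCost col + 9 * pendingInputs s p) (+-identityʳ (2 * k)))
  process-cost s (suc f) p {k} c (column S P) = begin
    2 * size′ r₂ + 4 * (count (mapMaybe (lift (extends r₂)) o) + justs os) + columnCost rest
      + 9 * pendingInputs s (suc f + p)
      ≡⟨ cong₂ (λ m q → 2 * size′ r₂ + 4 * (m + justs os) + columnCost rest + 9 * pendingInputs s q)
               (count-map (lift (extends r₂)) o) (sym (+-suc f p)) ⟩
    2 * size′ r₂ + 4 * (count o + justs os) + columnCost rest + 9 * pendingInputs s (f + suc p)
      ≡⟨ output-last (2 * size′ r₂) (count o) (justs os) (columnCost rest) (9 * pendingInputs s (f + suc p)) ⟩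
    2 * size′ r₂ + 4 * justs os + columnCost rest + 9 * pendingInputs s (f + suc p) + 4 * count o
      ≤⟨ +-monoˡ-≤ (4 * count o) (process-cost s f (suc p) c₁ carry) ⟩
    2 * size′ r₁ + columnCost carry + 9 * pendingInputs s (suc p) + 4 * count o
      ≡⟨ pending-last (2 * size′ r₁) (columnCost carry) (9 * pendingInputs s (suc p)) (4 * count o) ⟩
    grownCost r₁ + 9 * pendingInputs s (suc p)
      ≤⟨ +-monoˡ-≤ (9 * pendingInputs s (suc p)) (compressColumn-cost c (column (S ++ L) P)) ⟩
    2 * k + (9 * length (S ++ L) + 16 * length P) + 9 * pendingInputs s (suc p)
      ≡⟨ cong (λ l → 2 * k + (9 * l + 16 * length P) + 9 * pendingInputs s (suc p))
              (trans (length-++ S) (cong (length S +_) (length-map (inputNode k) (inputsAt s p)))) ⟩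
    2 * k + (9 * (length S + length (inputsAt s p)) + 16 * length P) + 9 * pendingInputs s (suc p)
      ≡⟨ inputs-first (2 * k) (length S) (length (inputsAt s p)) (length P) (pendingInputs s (suc p)) ⟩
    2 * k + columnCost (column S P) + 9 * (length (inputsAt s p) + pendingInputs s (suc p))
      ≡⟨ cong (λ v → 2 * k + columnCost (column S P) + 9 * v) (sym (pendingInputs-step s p)) ⟩
    2 * k + columnCost (column S P) + 9 * pendingInputs s p ∎
    where
    open ≤-Reasoning
    L = map (inputNode k) (inputsAt s p)
    r₁ = compressColumn c (column (S ++ L) P)
    c₁ = circuit r₁
    o = proj₁ (result r₁)
    carry = proj₂ (result r₁)
    r₂ = process s f (suc p) c₁ carry
    os = bits (result r₂)
    rest = leftover (result r₂)
    output-last : ∀ g o j c q → g + 4 * (o + j) + c + q ≡ g + 4 * j + c + q + 4 * o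
    output-last = solve-∀
    pending-last : ∀ g c q o → g + c + q + o ≡ g + (o + c) + q
    pending-last = solve-∀
    inputs-first : ∀ g s l p q → g + (9 * (s + l) + 16 * p) + 9 * q ≡ g + (9 * s + 16 * p) + 9 * (l + q)
    inputs-first = solve-∀

  outputNode : ∀ {k} → List (Maybe (Node k)) → ℕ → Node k
  outputNode {k} os q = fromMaybe (falseNode k) (nth os q)

  outputValue-fromMaybe : ∀ {k} (c : Gates n k) x o →
    outputValue c x o ≡ singleValue c x (fromMaybe (falseNode k) o)
  outputValue-fromMaybe c x nothing  = cong toℕ (sym (value-falseNode c x))
  outputValue-fromMaybe c x (just i) = refl

  bit-binaryValue : ∀ {k} (c : Gates n k) x os q →
    bit q (binaryValue c x os 0) ≡ value c x (outputNode os q)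
  bit-binaryValue {k} c x []       q       = trans (bit-zero q) (sym (value-falseNode c x))
  bit-binaryValue {k} c x (o ∷ os) zero    =
    trans (cong (λ v → bit 0 (v + 2 * binaryValue c x os 0)) (outputValue-fromMaybe c x o))
          (bit-lsb (value c x (fromMaybe (falseNode k) o)) (binaryValue c x os 0))
  bit-binaryValue {k} c x (o ∷ os) (suc q) =
    trans (cong (λ v → bit (suc q) (v + 2 * binaryValue c x os 0)) (outputValue-fromMaybe c x o))
          (trans (bit-shift q (value c x (fromMaybe (falseNode k) o)) (binaryValue c x os 0)) (bit-binaryValue c x os q))

  outputNode-true⇒Is-just : ∀ {k} (c : Gates n k) x os q → value c x (outputNode os q) ≡ true → Is-just (nth os q)
  outputNode-true⇒Is-just {k} c x os q holds with nth os q
  ... | just _  = just tt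
  ... | nothing with trans (sym (value-falseNode c x)) holds
  ... | ()

  binaryValue-≥ : ∀ {k} (c : Gates n k) x os y → 2 ^ length os * y ≤ binaryValue c x os y
  binaryValue-≥ c x []       y = ≤-reflexive (*-identityˡ y)
  binaryValue-≥ c x (o ∷ os) y = begin
    2 * 2 ^ length os * y           ≡⟨ *-assoc 2 (2 ^ length os) y ⟩
    2 * (2 ^ length os * y)         ≤⟨ *-monoʳ-≤ 2 (binaryValue-≥ c x os y) ⟩
    2 * binaryValue c x os y        ≤⟨ m≤n+m _ (outputValue c x o) ⟩
    binaryValue c x (o ∷ os) y      ∎
    where open ≤-Reasoning

  length-bits : ∀ (s : Fin n → ℕ) f p {k} (c : Gates n k) col →
                length (bits (result (process s f p c col))) ≡ f
  length-bits s zero    p c col          = refl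
  length-bits s (suc f) p c (column S P) = cong suc (length-bits s f (suc p) _ _)

module _ {n : ℕ} (s : Fin n → ℕ) where

  -- Every weighted sum is at most this, hence below 2 ^ columns.
  columns : ℕ
  columns = ∑[ i < n ] (2 ^ s i)

  adder : Grown {n} [] Processed
  adder = process s columns 0 [] (column [] [])

  weightedSum<2^columns : ∀ x → weightedSum s x < 2 ^ columns
  weightedSum<2^columns x = begin-strict
    weightedSum s x                            ≡⟨ sum-tabulate (λ i → if x i then 2 ^ s i else 0) ⟩
    ∑[ i < n ] (if x i then 2 ^ s i else 0)    ≤⟨ ∑-mono-≤ (λ i → summand≤ (x i) (2 ^ s i)) ⟩
    columns                                    <⟨ n<2^n columns ⟩
    2 ^ columns                                ∎
    where
    open ≤-Reasoning
    summand≤ : ∀ b w → (if b then w else 0) ≤ w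
    summand≤ true  w = ≤-refl
    summand≤ false w = z≤n

  -- After all columns the leftover carries and pending inputs are worth 0, since
  -- they carry the weight 2 ^ columns, which exceeds the whole sum.
  weightedSum-binary : ∀ x → weightedSum s x ≡ binaryValue (circuit adder) x (bits (result adder)) 0
  weightedSum-binary x = trans decomposition (cong (binaryValue c x os) high≡0)
    where
    c = circuit adder
    os = bits (result adder)
    high = columnValue c x (leftover (result adder)) + pendingValue s (columns + 0) x
    decomposition : weightedSum s x ≡ binaryValue c x os high
    decomposition = trans (sum-tabulate (λ i → if x i then 2 ^ s i else 0))
                          (process-value s columns 0 [] (column [] []) x)
    high≡0 : high ≡ 0
    high≡0 = m*n≤o<m⇒n≡0
      (subst (λ l → 2 ^ l * high ≤ binaryValue c x os high) (length-bits s columns 0 [] (column [] []))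
             (binaryValue-≥ c x os high))
      (subst (_< 2 ^ columns) decomposition (weightedSum<2^columns x))

  bit-weightedSum : ∀ x q → bit q (weightedSum s x) ≡ value (circuit adder) x (outputNode (bits (result adder)) q)
  bit-weightedSum x q =
    trans (cong (bit q) (weightedSum-binary x)) (bit-binaryValue (circuit adder) x (bits (result adder)) q)

  adder-cost : 2 * size′ adder + 4 * justs (bits (result adder)) ≤ 9 * n
  adder-cost = begin
    2 * size′ adder + 4 * justs (bits (result adder))
      ≤⟨ m≤m+n _ _ ⟩
    2 * size′ adder + 4 * justs (bits (result adder)) + columnCost (leftover (result adder))
      ≤⟨ m≤m+n _ _ ⟩
    2 * size′ adder + 4 * justs (bits (result adder)) + columnCost (leftover (result adder))
      + 9 * pendingInputs s (columns + 0)
      ≤⟨ process-cost s columns 0 [] (column [] []) ⟩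
    9 * ∑[ i < n ] 1
      ≡⟨ cong (9 *_) (∑-ones n) ⟩
    9 * n ∎
    where open ≤-Reasoning

theorem1 : (n : ℕ) → 1 ≤ n → (s : Fin n → ℕ) → (m : ℕ) → (t : Fin m → ℕ) →
    IsBitAdderPositions s t →
    Σ (Circuit n m) λ C → Computes C (BA s t) × (2 * size C + 4 * m ≤ 9 * n)
-- The bound also holds for n = 0.
theorem1 n _ s m t (increasing , occurring) = C , computes , bound
  where
  os = bits (result (adder s))
  C : Circuit n m
  C = record { size = size′ (adder s) ; gates = circuit (adder s) ; outputs = tabulate (outputNode os ∘ t) }
  computes : Computes C (BA s t)
  computes x j = trans (cong (value (circuit (adder s)) x) (lookup∘tabulate (outputNode os ∘ t) j))
                       (sym (bit-weightedSum s x (t j)))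
  occurs : ∀ j → Is-just (nth os (t j))
  occurs j = let x , bit≡true = proj₂ (occurring (t j)) (j , refl) in
    outputNode-true⇒Is-just (circuit (adder s)) x os (t j) (trans (sym (bit-weightedSum s x (t j))) bit≡true)
  bound : 2 * size′ (adder s) + 4 * m ≤ 9 * n
  bound = ≤-trans (+-monoʳ-≤ (2 * size′ (adder s)) (*-monoʳ-≤ 4 (increasing-≤-justs os t increasing occurs)))
                  (adder-cost s)
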